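{- Let $G$ be a simple odd multi-cactus with $G\neq K_2$, and let $v\in V(G)$. Then there is a map $w:E(G)\to\{0,1\}$ such that $v$ and every vertex in the bipartition class not containing $v$ have weighted degree $1$, and every other vertex has weighted degree $0$ or $2$.
   Context: An odd multi-cactus: take a collection of cycles of length $2 \pmod 4$, each with edges coloured alternately red and green; form a connected simple graph by pasting these cycles together one by one in a tree-like fashion along green edges; finally replace every green edge by a multiple edge of any multiplicity. A simple odd multi-cactus is one in which all multiplicities are $1$. For $w:E(G)\to\{0,1\}$, the weighted degree of a vertex $x$ is $\sum_{e\ni x}w(e)$. -}

module Defs where

open import Data.Nat using (ℕ; zero; suc; _+_; _*_; _≡ᵇ_)
open import Data.Bool using (Bool; if_then_else_; _∨_)
open import Data.Fin using (Fin; toℕ) renaming (zero to fzero; suc to fsuc)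
open import Data.List using (List; []; _∷_; _++_; map; upTo; length; [_])
open import Data.List.Membership.Propositional using (_∈_)
open import Data.Product using (_×_; _,_; proj₁; proj₂)
open import Data.Sum using (_⊎_)

-- An edge is an (unordered) pair of vertices, stored as an ordered pair.
-- Vertices of a graph with n vertices are the naturals 0 .. n-1.
Edge : Set
Edge = ℕ × ℕ

-- Pasting a new cycle of length 4(k+1)+2 onto the green edge {a,b} of a graph
-- with vertices 0..n-1.  The new vertices are n, n+1, ..., n+4k+3 and the
-- cycle is  a -g- b -r- n -g- n+1 -r- n+2 -g- ... -g- n+4k+3 -r- a.
newGreen : ℕ → ℕ → List Edge
newGreen n k = map (λ j → (n + 2 * j , n + 2 * j + 1)) (upTo (2 * suc k))

newRed : ℕ → ℕ → ℕ → ℕ → List Edge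
newRed n k a b =
  (b , n) ∷ (map (λ j → (n + 2 * j + 1 , n + 2 * j + 2)) (upTo (1 + 2 * k))
             ++ [ (n + 4 * k + 3 , a) ])

-- OddCactus n red green : the simple graph with vertex set {0..n-1} and edge
-- set red ++ green is a simple odd multi-cactus (all multiplicities 1), with
-- the given red/green colouring of its edges.
-- Step: paste a cycle of length ≡ 2 (mod 4) (length ≥ 6, as the graph is simple)
-- along an existing green edge, all other vertices of the cycle being new.
data OddCactus : ℕ → List Edge → List Edge → Set where
  k2    : OddCactus 2 [] [ (0 , 1) ]
  paste : ∀ {n red green} → OddCactus n red green →
          (a b : ℕ) → ((a , b) ∈ green ⊎ (b , a) ∈ green) → (k : ℕ) →
          OddCactus (n + 4 * suc k) (red ++ newRed n k a b) (green ++ newGreen n k)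

incident : Edge → ℕ → Bool
incident (a , b) x = (a ≡ᵇ x) ∨ (b ≡ᵇ x)

wdeg : (E : List Edge) → (Fin (length E) → Fin 2) → ℕ → ℕ
wdeg []      w x = 0
wdeg (e ∷ E) w x = (if incident e x then toℕ (w fzero) else 0) + wdeg E (λ i → w (fsuc i)) x

-- Induction along the pasting construction, for every root and every proper 2-colouring at once.
-- Pasting a cycle of length 4k+6 onto the green edge {a,b} adds a path b, n, n+1, …, n+4k+3, a.
-- Weight its edges by the 4-periodic sequence 1,0,0,1,… started at a phase s: two consecutive weights
-- then sum to 1 at every other inner vertex and to 0 or 2 at the rest, and s is chosen so that the
-- vertices with sum 1 are the ones coloured unlike the root v. If v is old, the phase also gives both
-- end edges weight 0 and the old weighting is kept. If v is new, the sequence skips two beats at v,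
-- which gives v the sum 1 too; the old weighting is then taken rooted at the end u ∈ {a,b} coloured
-- like v, the end edge at u gets weight 1 (so u goes from degree 1 to 2) and the other end edge gets 0.
-- Both end conditions hold because the path has 4k+5 ≡ 1 (mod 4) edges.

module Submission where

open import Defs
open import Data.Bool using (Bool; true; false; not; _xor_; if_then_else_)
open import Data.Bool.Properties using (¬-not; not-involutive; not-injective; not-distribˡ-xor; xor-same)
  renaming (_≟_ to _≟ᴮ_)
open import Data.Fin using (Fin; toℕ) renaming (zero to fzero; suc to fsuc)
open import Data.Fin.Patterns using (0F; 1F)
open import Data.List using (List; []; _∷_; _++_; length; map; upTo; applyUpTo; [_])
open import Data.List.Properties using (map-upTo)
open import Data.List.Membership.Propositional using (_∈_)
open import Data.List.Relation.Unary.All as All using (All; []; _∷_)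
open import Data.List.Relation.Unary.All.Properties using (++⁺; ++⁻)
open import Data.Nat using (ℕ; zero; suc; _+_; _*_; _∸_; _<_; _≤_; _≡ᵇ_; z≤n; s≤s; _<?_)
open import Data.Nat.Properties
open import Algebra.Properties.CommutativeSemigroup +-commutativeSemigroup using (interchange)
open import Data.Nat.Tactic.RingSolver using (solve-∀)
open import Data.Product using (Σ; ∃; _×_; _,_; proj₁; proj₂)
open import Function using (_∘_)
open import Data.Sum using (_⊎_; inj₁; inj₂)
open import Relation.Binary.Definitions using (tri<; tri≈; tri>)
open import Relation.Binary.PropositionalEquality hiding ([_])
open import Relation.Nullary using (¬_; does; yes; no; contradiction)
open import Relation.Nullary.Decidable using (dec-true; dec-false)

double : ℕ → ℕ
double zero    = zero
double (suc n) = suc (suc (double n))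

double≡2* : ∀ n → double n ≡ 2 * n
double≡2* zero    = refl
double≡2* (suc n) = trans (cong (λ m → suc (suc m)) (double≡2* n)) (sym (*-suc 2 n))

quadruple≡4* : ∀ m → double (double m) ≡ 4 * m
quadruple≡4* m = trans (trans (double≡2* (double m)) (cong (2 *_) (double≡2* m))) (sym (*-assoc 2 2 m))

double-injective : ∀ {i j} → double i ≡ double j → i ≡ j
double-injective {zero}  {zero}  _  = refl
double-injective {suc i} {suc j} eq = cong suc (double-injective (suc-injective (suc-injective eq)))

double≢suc-double : ∀ i j → double i ≢ suc (double j)
double≢suc-double (suc i) (suc j) eq = double≢suc-double i j (suc-injective (suc-injective eq))

+-suc-suc : ∀ m n → m + suc (suc n) ≡ suc (suc (m + n))
+-suc-suc m n = trans (+-suc m (suc n)) (cong suc (+-suc m n))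

double-cancel-< : ∀ {i j} → double i < double j → i < j
double-cancel-< {zero}  {suc j} _               = s≤s z≤n
double-cancel-< {suc i} {suc j} (s≤s (s≤s 2i<2j)) = s≤s (double-cancel-< 2i<2j)

data Half : ℕ → Set where
  even : ∀ i → Half (double i)
  odd  : ∀ i → Half (suc (double i))

half : ∀ p → Half p
half zero    = even zero
half (suc p) with half p
... | even i = odd i
... | odd i  = even (suc i)

-- Weights are stored alongside the edge list, so weightings of concatenated lists split and join.
Weighting : List Edge → Set
Weighting = All (λ _ → Fin 2)

contribution : Edge → Fin 2 → ℕ → ℕ
contribution e w x = if incident e x then toℕ w else 0

degree : ∀ {E} → Weighting E → ℕ → ℕ
degree {[]}    []      x = 0
degree {e ∷ E} (w ∷ W) x = contribution e w x + degree W x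

weightAt : ∀ {E} → Weighting E → Fin (length E) → Fin 2
weightAt (w ∷ W) fzero    = w
weightAt (w ∷ W) (fsuc i) = weightAt W i

wdeg-weightAt : ∀ {E} (W : Weighting E) x → wdeg E (weightAt W) x ≡ degree W x
wdeg-weightAt []      x = refl
wdeg-weightAt (w ∷ W) x = cong (_ +_) (wdeg-weightAt W x)

degree-++⁺ : ∀ {E F} (V : Weighting E) (W : Weighting F) x →
             degree (++⁺ V W) x ≡ degree V x + degree W x
degree-++⁺ []      W x = refl
degree-++⁺ {e ∷ E} (v ∷ V) W x =
  trans (cong (contribution e v x +_) (degree-++⁺ V W x)) (sym (+-assoc (contribution e v x) _ _))

degree-++⁻ : ∀ E {F} (W : Weighting (E ++ F)) x →
             degree W x ≡ degree (proj₁ (++⁻ E W)) x + degree (proj₂ (++⁻ E W)) x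
degree-++⁻ []      W       x = refl
degree-++⁻ (e ∷ E) (w ∷ W) x =
  trans (cong (contribution e w x +_) (degree-++⁻ E W x)) (sym (+-assoc (contribution e w x) _ _))

≡ᵇ-refl : ∀ x → (x ≡ᵇ x) ≡ true
≡ᵇ-refl x = dec-true (x ≟ x) refl

≢⇒≡ᵇ-false : ∀ {x y} → x ≢ y → (x ≡ᵇ y) ≡ false
≢⇒≡ᵇ-false x≢y = dec-false (_ ≟ _) x≢y

contribution-fst : ∀ x q w → contribution (x , q) w x ≡ toℕ w
contribution-fst x q w rewrite ≡ᵇ-refl x = refl

contribution-snd : ∀ p x w → contribution (p , x) w x ≡ toℕ w
contribution-snd p x w rewrite ≡ᵇ-refl x with p ≡ᵇ x
... | true  = refl
... | false = refl

contribution-miss : ∀ {p q x} w → p ≢ x → q ≢ x → contribution (p , q) w x ≡ 0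
contribution-miss w p≢x q≢x rewrite ≢⇒≡ᵇ-false p≢x | ≢⇒≡ᵇ-false q≢x = refl

degree-hit-fst : ∀ {E} x q w (W : Weighting E) → degree {(x , q) ∷ E} (w ∷ W) x ≡ toℕ w + degree W x
degree-hit-fst x q w W = cong (_+ degree W x) (contribution-fst x q w)

degree-hit-snd : ∀ {E} p x w (W : Weighting E) → degree {(p , x) ∷ E} (w ∷ W) x ≡ toℕ w + degree W x
degree-hit-snd p x w W = cong (_+ degree W x) (contribution-snd p x w)

degree-miss : ∀ {p q E} w (W : Weighting E) {x} → p ≢ x → q ≢ x →
              degree {(p , q) ∷ E} (w ∷ W) x ≡ degree W x
degree-miss w W p≢x q≢x = cong (_+ degree W _) (contribution-miss w p≢x q≢x)

Below : ℕ → Edge → Set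
Below n (p , q) = p < n × q < n

degree-beyond : ∀ {n E} → All (Below n) E → (W : Weighting E) → ∀ {x} → n ≤ x → degree W x ≡ 0
degree-beyond []                 []      n≤x = refl
degree-beyond ((p<n , q<n) ∷ bs) (w ∷ W) n≤x =
  trans (degree-miss w W (<⇒≢ (<-≤-trans p<n n≤x)) (<⇒≢ (<-≤-trans q<n n≤x))) (degree-beyond bs W n≤x)

module _ {A : Set} {P : A → Set} where

  All-interleave : ∀ B C D F → All P (B ++ C) → All P (D ++ F) → All P ((B ++ D) ++ (C ++ F))
  All-interleave B C D F bc df =
    ++⁺ (++⁺ (proj₁ (++⁻ B bc)) (proj₁ (++⁻ D df))) (++⁺ (proj₂ (++⁻ B bc)) (proj₂ (++⁻ D df)))

  All-deinterleave : ∀ B C D F → All P ((B ++ D) ++ (C ++ F)) → All P (B ++ C) × All P (D ++ F)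
  All-deinterleave B C D F p =
    ++⁺ (proj₁ (++⁻ B bd)) (proj₁ (++⁻ C cf)) , ++⁺ (proj₂ (++⁻ B bd)) (proj₂ (++⁻ C cf))
    where
      bd = proj₁ (++⁻ (B ++ D) p)
      cf = proj₂ (++⁻ (B ++ D) p)

degree-interleave : ∀ B C D F (V : Weighting (B ++ C)) (W : Weighting (D ++ F)) x →
                    degree (All-interleave B C D F V W) x ≡ degree V x + degree W x
degree-interleave B C D F V W x = begin
  degree (All-interleave B C D F V W) x
    ≡⟨ degree-++⁺ (++⁺ V₁ W₁) (++⁺ V₂ W₂) x ⟩
  degree (++⁺ V₁ W₁) x + degree (++⁺ V₂ W₂) x
    ≡⟨ cong₂ _+_ (degree-++⁺ V₁ W₁ x) (degree-++⁺ V₂ W₂ x) ⟩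
  (degree V₁ x + degree W₁ x) + (degree V₂ x + degree W₂ x)
    ≡⟨ interchange (degree V₁ x) (degree W₁ x) (degree V₂ x) (degree W₂ x) ⟩
  (degree V₁ x + degree V₂ x) + (degree W₁ x + degree W₂ x)
    ≡⟨ cong₂ _+_ (degree-++⁻ B V x) (degree-++⁻ D W x) ⟨
  degree V x + degree W x ∎
  where
    open ≡-Reasoning
    V₁ = proj₁ (++⁻ B V)
    V₂ = proj₂ (++⁻ B V)
    W₁ = proj₁ (++⁻ D W)
    W₂ = proj₂ (++⁻ D W)

All-lookup-sym : ∀ {P : Edge → Set} {E a b} → (∀ {p q} → P (p , q) → P (q , p)) → All P E →
                 (a , b) ∈ E ⊎ (b , a) ∈ E → P (a , b)
All-lookup-sym P-sym ps (inj₁ ab∈E) = All.lookup ps ab∈E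
All-lookup-sym P-sym ps (inj₂ ba∈E) = P-sym (All.lookup ps ba∈E)

Below-sym : ∀ {n p q} → Below n (p , q) → Below n (q , p)
Below-sym (p<n , q<n) = q<n , p<n

pairs : ℕ → ℕ → List Edge
pairs c zero    = []
pairs c (suc m) = (c , suc c) ∷ pairs (suc (suc c)) m

pairWeighting : ∀ c m → (ℕ → Fin 2) → Weighting (pairs c m)
pairWeighting c zero    u = []
pairWeighting c (suc m) u = u 0 ∷ pairWeighting (suc (suc c)) m (u ∘ suc)

private
  c<2+c+d : ∀ c d → c < suc (suc (c + d))
  c<2+c+d c d = s≤s (m≤n⇒m≤1+n (m≤m+n c d))

  1+c<2+c+d : ∀ c d → suc c < suc (suc (c + d))
  1+c<2+c+d c d = s≤s (s≤s (m≤m+n c d))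

degree-pairs-below : ∀ c m u {x} → x < c → degree (pairWeighting c m u) x ≡ 0
degree-pairs-below c zero    u x<c = refl
degree-pairs-below c (suc m) u x<c =
  trans (degree-miss (u 0) (pairWeighting (suc (suc c)) m (u ∘ suc))
                     (≢-sym (<⇒≢ x<c)) (≢-sym (<⇒≢ (m<n⇒m<1+n x<c))))
        (degree-pairs-below (suc (suc c)) m (u ∘ suc) (m<n⇒m<1+n (m<n⇒m<1+n x<c)))

degree-pairs-above : ∀ c m u {x} → c + double m ≤ x → degree (pairWeighting c m u) x ≡ 0
degree-pairs-above c zero    u c≤x = refl
degree-pairs-above c (suc m) u {x} c+2m+2≤x =
  trans (degree-miss (u 0) (pairWeighting (suc (suc c)) m (u ∘ suc))
                     (<⇒≢ (<-trans (n<1+n c) 1+c<x)) (<⇒≢ 1+c<x))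
        (degree-pairs-above (suc (suc c)) m (u ∘ suc) 2+c+2m≤x)
  where
    2+c+2m≤x : suc (suc c) + double m ≤ x
    2+c+2m≤x = subst (_≤ x) (+-suc-suc c (double m)) c+2m+2≤x

    1+c<x : suc c < x
    1+c<x = <-≤-trans (1+c<2+c+d c (double m)) 2+c+2m≤x

degree-pairs-fst : ∀ c m u j → j < m → degree (pairWeighting c m u) (c + double j) ≡ toℕ (u j)
degree-pairs-fst c (suc m) u zero _ rewrite +-identityʳ c =
  trans (degree-hit-fst c (suc c) (u 0) (pairWeighting (suc (suc c)) m (u ∘ suc)))
        (trans (cong (toℕ (u 0) +_) (degree-pairs-below (suc (suc c)) m (u ∘ suc) (m<n⇒m<1+n (n<1+n c))))
               (+-identityʳ _))
degree-pairs-fst c (suc m) u (suc j) (s≤s j<m) rewrite +-suc-suc c (double j) =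
  trans (degree-miss (u 0) (pairWeighting (suc (suc c)) m (u ∘ suc))
                     (<⇒≢ (c<2+c+d c (double j))) (<⇒≢ (1+c<2+c+d c (double j))))
        (degree-pairs-fst (suc (suc c)) m (u ∘ suc) j j<m)

degree-pairs-snd : ∀ c m u j → j < m → degree (pairWeighting c m u) (suc (c + double j)) ≡ toℕ (u j)
degree-pairs-snd c (suc m) u zero _ rewrite +-identityʳ c =
  trans (degree-hit-snd c (suc c) (u 0) (pairWeighting (suc (suc c)) m (u ∘ suc)))
        (trans (cong (toℕ (u 0) +_) (degree-pairs-below (suc (suc c)) m (u ∘ suc) (n<1+n (suc c))))
               (+-identityʳ _))
degree-pairs-snd c (suc m) u (suc j) (s≤s j<m) rewrite +-suc-suc c (double j) =
  trans (degree-miss (u 0) (pairWeighting (suc (suc c)) m (u ∘ suc))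
                     (<⇒≢ (m<n⇒m<1+n (c<2+c+d c (double j)))) (<⇒≢ (m<n⇒m<1+n (1+c<2+c+d c (double j)))))
        (degree-pairs-snd (suc (suc c)) m (u ∘ suc) j j<m)

pairs-below : ∀ c m {N} → c + double m ≤ N → All (Below N) (pairs c m)
pairs-below c zero    _ = []
pairs-below c (suc m) c+2m+2≤N rewrite +-suc-suc c (double m) =
  (<-≤-trans (c<2+c+d c (double m)) c+2m+2≤N , <-≤-trans (1+c<2+c+d c (double m)) c+2m+2≤N)
  ∷ pairs-below (suc (suc c)) m c+2m+2≤N

All-pairs : ∀ {P : Edge → Set} c m → All P (pairs c m) → ∀ j → j < m → P (c + double j , suc (c + double j))
All-pairs {P} c (suc m) (p ∷ ps) zero    _ = subst (λ z → P (z , suc z)) (sym (+-identityʳ c)) p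
All-pairs {P} c (suc m) (p ∷ ps) (suc j) (s≤s j<m) =
  subst (λ z → P (z , suc z)) (sym (+-suc-suc c (double j))) (All-pairs (suc (suc c)) m ps j j<m)

applyUpTo-pairs : ∀ c m (g : ℕ → Edge) → (∀ j → g j ≡ (c + double j , suc (c + double j))) →
                  applyUpTo g m ≡ pairs c m
applyUpTo-pairs c zero    g g≡ = refl
applyUpTo-pairs c (suc m) g g≡ =
  cong₂ _∷_ (trans (g≡ 0) (cong (λ z → (z , suc z)) (+-identityʳ c)))
            (applyUpTo-pairs (suc (suc c)) m (λ j → g (suc j))
              (λ j → trans (g≡ (suc j)) (cong (λ z → (z , suc z)) (+-suc-suc c (double j)))))

adjacentSum : (ℕ → Fin 2) → ℕ → ℕ
adjacentSum t p = toℕ (t p) + toℕ (t (suc p))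

Proper : (ℕ → Bool) → Edge → Set
Proper col e = col (proj₁ e) ≢ col (proj₂ e)

-- The path b, n, n+1, …, n+2r+1, a split into its red and green matchings; its i-th edge
-- (counted from b) gets the weight t i.
module Path (n r a b : ℕ) where

  redPath : List Edge
  redPath = (b , n) ∷ (pairs (suc n) r ++ [ (suc (n + double r) , a) ])

  greenPath : List Edge
  greenPath = pairs n (suc r)

  middleWeight greenWeight : (ℕ → Fin 2) → ℕ → Fin 2
  middleWeight t j = t (suc (suc (double j)))
  greenWeight  t j = t (suc (double j))

  middleWeighting : (ℕ → Fin 2) → Weighting (pairs (suc n) r)
  middleWeighting t = pairWeighting (suc n) r (middleWeight t)

  redWeighting : (ℕ → Fin 2) → Weighting redPath
  redWeighting t = t 0 ∷ ++⁺ (middleWeighting t) (t (double (suc r)) ∷ [])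

  greenWeighting : (ℕ → Fin 2) → Weighting greenPath
  greenWeighting t = pairWeighting n (suc r) (greenWeight t)

  pathDegree : (ℕ → Fin 2) → ℕ → ℕ
  pathDegree t x = degree (redWeighting t) x + degree (greenWeighting t) x

  redDegree : ∀ t x → degree (redWeighting t) x ≡
              contribution (b , n) (t 0) x + degree (middleWeighting t) x
              + contribution (suc (n + double r) , a) (t (double (suc r))) x
  redDegree t x =
    trans (cong (contribution (b , n) (t 0) x +_)
                (trans (degree-++⁺ (middleWeighting t) _ x)
                       (cong (degree (middleWeighting t) x +_) (+-identityʳ _))))
          (sym (+-assoc (contribution (b , n) (t 0) x) _ _))

  module _ (a<n : a < n) (b<n : b < n) where

    private
      n<1+n+d : ∀ d → n < suc (n + d)
      n<1+n+d d = s≤s (m≤m+n n d)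

      n<2+n+d : ∀ d → n < suc (suc (n + d))
      n<2+n+d d = m<n⇒m<1+n (n<1+n+d d)

      old≢new : ∀ {x y} → x < n → n < y → x ≢ y
      old≢new x<n n<y = <⇒≢ (<-trans x<n n<y)

      last≢even : ∀ i → suc (n + double r) ≢ suc (suc (n + double i))
      last≢even i eq = double≢suc-double r i
        (+-cancelˡ-≡ n _ _ (trans (suc-injective eq) (sym (+-suc n (double i)))))

      last≢old : ∀ {x} → x < n → suc (n + double r) ≢ x
      last≢old x<n = ≢-sym (old≢new x<n (n<1+n+d (double r)))

      last≢odd : ∀ {i} → i < r → suc (n + double r) ≢ suc (n + double i)
      last≢odd i<r eq = <⇒≢ i<r (sym (double-injective (+-cancelˡ-≡ n _ _ (suc-injective eq))))

    pathDegree-b : a ≢ b → ∀ t → pathDegree t b ≡ toℕ (t 0)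
    pathDegree-b a≢b t
      rewrite redDegree t b | contribution-fst b n (t 0)
            | degree-pairs-below (suc n) r (middleWeight t) (m<n⇒m<1+n b<n)
            | contribution-miss (t (double (suc r))) (last≢old b<n) a≢b
            | degree-pairs-below n (suc r) (greenWeight t) b<n
      = trans (+-identityʳ _) (trans (+-identityʳ _) (+-identityʳ _))

    pathDegree-a : a ≢ b → ∀ t → pathDegree t a ≡ toℕ (t (double (suc r)))
    pathDegree-a a≢b t
      rewrite redDegree t a | contribution-miss (t 0) (≢-sym a≢b) (≢-sym (<⇒≢ a<n))
            | degree-pairs-below (suc n) r (middleWeight t) (m<n⇒m<1+n a<n)
            | contribution-snd (suc (n + double r)) a (t (double (suc r)))
            | degree-pairs-below n (suc r) (greenWeight t) a<n
      = +-identityʳ _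

    pathDegree-old : ∀ t {x} → x < n → x ≢ a → x ≢ b → pathDegree t x ≡ 0
    pathDegree-old t {x} x<n x≢a x≢b
      rewrite redDegree t x | contribution-miss (t 0) (≢-sym x≢b) (≢-sym (<⇒≢ x<n))
            | degree-pairs-below (suc n) r (middleWeight t) (m<n⇒m<1+n x<n)
            | contribution-miss (t (double (suc r))) (last≢old x<n) (≢-sym x≢a)
            | degree-pairs-below n (suc r) (greenWeight t) x<n
      = refl

    pathDegree-quiet : a ≢ b → ∀ t → toℕ (t 0) ≡ 0 → toℕ (t (double (suc r))) ≡ 0 →
                       ∀ {x} → x < n → pathDegree t x ≡ 0
    pathDegree-quiet a≢b t t₀≡0 tℓ≡0 {x} x<n with x ≟ a | x ≟ b
    ... | yes refl | _        = trans (pathDegree-a a≢b t) tℓ≡0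
    ... | no _     | yes refl = trans (pathDegree-b a≢b t) t₀≡0
    ... | no x≢a   | no x≢b   = pathDegree-old t x<n x≢a x≢b

    redDegree-even : ∀ t i → i < suc r → degree (redWeighting t) (n + double i) ≡ toℕ (t (double i))
    redDegree-even t zero _
      rewrite +-identityʳ n | redDegree t n | contribution-snd b n (t 0)
            | degree-pairs-below (suc n) r (middleWeight t) (n<1+n n)
            | contribution-miss (t (double (suc r))) (≢-sym (<⇒≢ (n<1+n+d (double r)))) (<⇒≢ a<n)
      = trans (+-identityʳ _) (+-identityʳ _)
    redDegree-even t (suc i) (s≤s i<r)
      rewrite +-suc-suc n (double i) | redDegree t (suc (suc (n + double i)))
            | contribution-miss (t 0) (old≢new b<n (n<2+n+d (double i))) (<⇒≢ (n<2+n+d (double i)))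
            | degree-pairs-snd (suc n) r (middleWeight t) i i<r
            | contribution-miss (t (double (suc r))) (last≢even i) (old≢new a<n (n<2+n+d (double i)))
      = +-identityʳ _

    redDegree-odd : ∀ t i → i < suc r → degree (redWeighting t) (suc (n + double i)) ≡ toℕ (t (suc (suc (double i))))
    redDegree-odd t i i<1+r with m<1+n⇒m<n∨m≡n i<1+r
    ... | inj₁ i<r
      rewrite redDegree t (suc (n + double i))
            | contribution-miss (t 0) (old≢new b<n (n<1+n+d (double i))) (<⇒≢ (n<1+n+d (double i)))
            | degree-pairs-fst (suc n) r (middleWeight t) i i<r
            | contribution-miss (t (double (suc r))) (last≢odd i<r) (old≢new a<n (n<1+n+d (double i)))
      = +-identityʳ _
    ... | inj₂ refl
      rewrite redDegree t (suc (n + double r))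
            | contribution-miss (t 0) (old≢new b<n (n<1+n+d (double r))) (<⇒≢ (n<1+n+d (double r)))
            | degree-pairs-above (suc n) r (middleWeight t) ≤-refl
            | contribution-fst (suc (n + double r)) a (t (double (suc r)))
      = refl

    pathDegree-new : ∀ t p → p < double (suc r) → pathDegree t (n + p) ≡ adjacentSum t p
    pathDegree-new t p p<ℓ with half p
    ... | even i =
      cong₂ _+_ (redDegree-even t i i<1+r) (degree-pairs-fst n (suc r) (greenWeight t) i i<1+r)
      where i<1+r = double-cancel-< p<ℓ
    ... | odd i rewrite +-suc n (double i) =
      trans (cong₂ _+_ (redDegree-odd t i i<1+r) (degree-pairs-snd n (suc r) (greenWeight t) i i<1+r))
            (+-comm (toℕ (t (suc (suc (double i))))) _)
      where i<1+r = double-cancel-< (<-trans (n<1+n _) p<ℓ)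

    path-below : All (Below (n + double (suc r))) (redPath ++ greenPath)
    path-below =
      ++⁺ ((<-trans b<n n<N , n<N) ∷ ++⁺ (pairs-below (suc n) r (<⇒≤ last<N)) ((last<N , <-trans a<n n<N) ∷ []))
          (pairs-below n (suc r) ≤-refl)
      where
        last<N : suc (n + double r) < n + double (suc r)
        last<N = subst (suc (n + double r) <_) (sym (+-suc-suc n (double r))) (n<1+n _)
        n<N : n < n + double (suc r)
        n<N = <-trans (n<1+n+d (double r)) last<N

  module _ (col : ℕ → Bool) (proper : All (Proper col) (redPath ++ greenPath)) where

    private
      proper-red = proj₁ (++⁻ redPath proper)
      proper-green = proj₂ (++⁻ redPath proper)
      proper-middle = proj₁ (++⁻ (pairs (suc n) r) (All.tail proper-red))

    colour-even : ∀ i → i < suc r → col (n + double i) ≡ not (col b)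
    colour-odd  : ∀ i → i < suc r → col (suc (n + double i)) ≡ col b

    colour-even zero _ rewrite +-identityʳ n = ¬-not (≢-sym (All.head proper-red))
    colour-even (suc i) (s≤s i<r) rewrite +-suc-suc n (double i) =
      trans (¬-not (≢-sym (All-pairs (suc n) r proper-middle i i<r))) (cong not (colour-odd i (m<n⇒m<1+n i<r)))

    colour-odd i i<1+r =
      trans (¬-not (≢-sym (All-pairs n (suc r) proper-green i i<1+r)))
            (trans (cong not (colour-even i i<1+r)) (not-involutive (col b)))

isOdd : ℕ → Bool
isOdd zero          = false
isOdd (suc zero)    = true
isOdd (suc (suc n)) = isOdd n

isOdd-suc : ∀ n → isOdd (suc n) ≡ not (isOdd n)
isOdd-suc zero          = refl
isOdd-suc (suc zero)    = refl
isOdd-suc (suc (suc n)) = isOdd-suc n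

isOdd-double-+ : ∀ i s → isOdd (double i + s) ≡ isOdd s
isOdd-double-+ zero    s = refl
isOdd-double-+ (suc i) s = isOdd-double-+ i s

xor-≡ : ∀ {x y} → x ≡ y → x xor y ≡ false
xor-≡ {x} refl = xor-same x

xor-≢ : ∀ {x y} → x ≢ y → x xor y ≡ true
xor-≢ {false} {false} x≢y = contradiction refl x≢y
xor-≢ {false} {true}  _   = refl
xor-≢ {true}  {false} _   = refl
xor-≢ {true}  {true}  x≢y = contradiction refl x≢y

Fits : Bool → ℕ → Set
Fits true  d = d ≡ 1
Fits false d = d ≡ 0 ⊎ d ≡ 2

cyclePattern : ℕ → Fin 2
cyclePattern 0 = 1F
cyclePattern 1 = 0F
cyclePattern 2 = 0F
cyclePattern 3 = 1F
cyclePattern (suc (suc (suc (suc y)))) = cyclePattern y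

cyclePattern-period : ∀ j y → cyclePattern (double (double j) + y) ≡ cyclePattern y
cyclePattern-period zero    y = refl
cyclePattern-period (suc j) y = cyclePattern-period j y

cyclePattern-adjacent : ∀ y → Fits (not (isOdd y)) (adjacentSum cyclePattern y)
cyclePattern-adjacent 0 = refl
cyclePattern-adjacent 1 = inj₁ refl
cyclePattern-adjacent 2 = refl
cyclePattern-adjacent 3 = inj₂ refl
cyclePattern-adjacent (suc (suc (suc (suc y)))) = cyclePattern-adjacent y

cyclePattern-skip : ∀ y → Fits (isOdd y) (toℕ (cyclePattern y) + toℕ (cyclePattern (3 + y)))
cyclePattern-skip 0 = inj₂ refl
cyclePattern-skip 1 = refl
cyclePattern-skip 2 = inj₁ refl
cyclePattern-skip 3 = refl
cyclePattern-skip (suc (suc (suc (suc y)))) = cyclePattern-skip y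

defectPattern : ℕ → ℕ → ℕ → Fin 2
defectPattern s q y = if does (y <? q) then cyclePattern (y + s) else cyclePattern (2 + (y + s))

defectPattern-before : ∀ {s q y} → y < q → defectPattern s q y ≡ cyclePattern (y + s)
defectPattern-before {y = y} y<q rewrite dec-true (y <? _) y<q = refl

defectPattern-after : ∀ {s q y} → q ≤ y → defectPattern s q y ≡ cyclePattern (2 + (y + s))
defectPattern-after {y = y} q≤y rewrite dec-false (y <? _) (≤⇒≯ q≤y) = refl

defectPattern-away : ∀ s q p → suc p ≢ q → Fits (not (isOdd (p + s))) (adjacentSum (defectPattern s q) p)
defectPattern-away s q p 1+p≢q with <-cmp (suc p) q
... | tri< 1+p<q _ _
  rewrite defectPattern-before {s} (<-trans (n<1+n p) 1+p<q) | defectPattern-before {s} 1+p<q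
  = cyclePattern-adjacent (p + s)
... | tri≈ _ 1+p≡q _ = contradiction 1+p≡q 1+p≢q
... | tri> _ _ q<1+p
  rewrite defectPattern-after {s} (m<1+n⇒m≤n q<1+p) | defectPattern-after {s} (<⇒≤ q<1+p)
  = cyclePattern-adjacent (2 + (p + s))

defectPattern-at : ∀ s p → Fits (isOdd (p + s)) (adjacentSum (defectPattern s (suc p)) p)
defectPattern-at s p
  rewrite defectPattern-before {s} (n<1+n p) | defectPattern-after {s} (≤-refl {suc p})
  = cyclePattern-skip (p + s)

record Prescribed (col : ℕ → Bool) (v x d : ℕ) : Set where
  field
    at-root : x ≡ v → d ≡ 1
    across  : col x ≢ col v → d ≡ 1
    beside  : x ≢ v → col x ≡ col v → d ≡ 0 ⊎ d ≡ 2

module _ {col : ℕ → Bool} {v x d : ℕ} where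

  prescribed-root : x ≡ v → d ≡ 1 → Prescribed col v x d
  prescribed-root x≡v d≡1 = record
    { at-root = λ _ → d≡1 ; across = λ _ → d≡1 ; beside = λ x≢v _ → contradiction x≡v x≢v }

  prescribed-across : col x ≢ col v → d ≡ 1 → Prescribed col v x d
  prescribed-across cx≢cv d≡1 = record
    { at-root = λ _ → d≡1 ; across = λ _ → d≡1 ; beside = λ _ cx≡cv → contradiction cx≡cv cx≢cv }

  prescribed-beside : x ≢ v → col x ≡ col v → d ≡ 0 ⊎ d ≡ 2 → Prescribed col v x d
  prescribed-beside x≢v cx≡cv d∈02 = record
    { at-root = λ x≡v → contradiction x≡v x≢v
    ; across  = λ cx≢cv → contradiction cx≡cv cx≢cv
    ; beside  = λ _ _ → d∈02 }

  prescribed-off-root : x ≢ v → Fits (col x xor col v) d → Prescribed col v x d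
  prescribed-off-root x≢v fits with col x ≟ᴮ col v
  ... | yes cx≡cv = prescribed-beside x≢v cx≡cv (subst (λ β → Fits β d) (xor-≡ cx≡cv) fits)
  ... | no  cx≢cv = prescribed-across cx≢cv (subst (λ β → Fits β d) (xor-≢ cx≢cv) fits)

  prescribed-transfer : ∀ {u} → x ≢ u → x ≢ v → col u ≡ col v → Prescribed col u x d → Prescribed col v x d
  prescribed-transfer x≢u x≢v cu≡cv p = record
    { at-root = λ x≡v → contradiction x≡v x≢v
    ; across  = λ cx≢cv → Prescribed.across p (λ cx≡cu → cx≢cv (trans cx≡cu cu≡cv))
    ; beside  = λ _ cx≡cv → Prescribed.beside p x≢u (trans cx≡cv (sym cu≡cv)) }

Rooted : ℕ → (E : List Edge) → (ℕ → Bool) → ℕ → Set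
Rooted n E col v = Σ (Weighting E) λ W → ∀ x → x < n → Prescribed col v x (degree W x)

Rootable : ℕ → List Edge → Set
Rootable n E = ∀ col → All (Proper col) E → ∀ v → v < n → Rooted n E col v

-- The extra unit at u turns its degree 1 into 2, as required once v is the root.
reroot : ∀ {n col u u′ v} (d e : ℕ → ℕ) → u < n → n ≤ v → col u ≡ col v → col u′ ≢ col u →
         (∀ x → x < n → Prescribed col u x (d x)) →
         e u ≡ 1 → e u′ ≡ 0 → (∀ x → x < n → x ≢ u → x ≢ u′ → e x ≡ 0) →
         ∀ x → x < n → Prescribed col v x (d x + e x)
reroot {u = u} {u′} d e u<n n≤v cu≡cv cu′≢cu prescribed eu≡1 eu′≡0 e-elsewhere x x<n
  with x ≟ u | x ≟ u′
... | yes refl | _ =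
  prescribed-beside (<⇒≢ (<-≤-trans u<n n≤v)) cu≡cv
    (inj₂ (cong₂ _+_ (Prescribed.at-root (prescribed x x<n) refl) eu≡1))
... | no _ | yes refl =
  prescribed-across (λ cu′≡cv → cu′≢cu (trans cu′≡cv (sym cu≡cv)))
    (cong₂ _+_ (Prescribed.across (prescribed x x<n) cu′≢cu) eu′≡0)
... | no x≢u | no x≢u′ rewrite e-elsewhere x x<n x≢u x≢u′ | +-identityʳ (d x) =
  prescribed-transfer x≢u (λ x≡v → <⇒≢ (<-≤-trans x<n n≤v) x≡v) cu≡cv (prescribed x x<n)

data OldOrNew (n : ℕ) : ℕ → Set where
  old : ∀ {x} → x < n → OldOrNew n x
  new : ∀ p → OldOrNew n (n + p)

oldOrNew : ∀ n x → OldOrNew n x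
oldOrNew n x with x <? n
... | yes x<n = old x<n
... | no  x≮n = subst (OldOrNew n) (m+[n∸m]≡n (≮⇒≥ x≮n)) (new (x ∸ n))

module Pasting {n : ℕ} {red green : List Edge} (bounded : All (Below n) (red ++ green))
               (rootable : Rootable n (red ++ green))
               {a b : ℕ} (ab∈green : (a , b) ∈ green ⊎ (b , a) ∈ green) (k : ℕ) where

  open Path n (suc (double k)) a b

  ℓ : ℕ
  ℓ = double (double (suc k))

  pasted : List Edge
  pasted = (red ++ redPath) ++ (green ++ greenPath)

  private
    a<n : a < n
    a<n = proj₁ (All-lookup-sym Below-sym (proj₂ (++⁻ red bounded)) ab∈green)

    b<n : b < n
    b<n = proj₂ (All-lookup-sym Below-sym (proj₂ (++⁻ red bounded)) ab∈green)

  defectPattern-end : ∀ s q → q ≤ ℓ → defectPattern s q ℓ ≡ cyclePattern (2 + s)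
  defectPattern-end s q q≤ℓ =
    trans (defectPattern-after q≤ℓ)
          (trans (cong cyclePattern (sym (+-suc-suc ℓ s))) (cyclePattern-period (suc k) (2 + s)))

  extend : Weighting (red ++ green) → (ℕ → Fin 2) → Weighting pasted
  extend W t = All-interleave red green redPath greenPath W (++⁺ (redWeighting t) (greenWeighting t))

  degree-extend : ∀ W t x → degree (extend W t) x ≡ degree W x + pathDegree t x
  degree-extend W t x =
    trans (degree-interleave red green redPath greenPath W _ x)
          (cong (degree W x +_) (degree-++⁺ (redWeighting t) (greenWeighting t) x))

  module Coloured {col : ℕ → Bool} (proper : All (Proper col) pasted) where

    private
      proper-old  = proj₁ (All-deinterleave red green redPath greenPath proper)
      proper-path = proj₂ (All-deinterleave red green redPath greenPath proper)

      ca≢cb : col a ≢ col b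
      ca≢cb = All-lookup-sym ≢-sym (proj₂ (++⁻ red proper-old)) ab∈green

      a≢b : a ≢ b
      a≢b a≡b = ca≢cb (cong col a≡b)

    extend-rooted : ∀ {v} W t → (∀ x → x < n → Prescribed col v x (degree W x + pathDegree t x)) →
                    (∀ p → p < ℓ → Prescribed col v (n + p) (adjacentSum t p)) →
                    Rooted (n + ℓ) pasted col v
    extend-rooted {v} W t old-ok new-ok = extend W t , prescribed
      where
        prescribed : ∀ x → x < n + ℓ → Prescribed col v x (degree (extend W t) x)
        prescribed x x<N with oldOrNew n x
        ... | old x<n = subst (Prescribed col v x) (sym (degree-extend W t x)) (old-ok x x<n)
        ... | new p   = subst (Prescribed col v (n + p)) (sym degree≡) (new-ok p p<ℓ)
          where
            p<ℓ = +-cancelˡ-< n p ℓ x<N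
            degree≡ = trans (degree-extend W t (n + p))
                            (cong₂ _+_ (degree-beyond bounded W (m≤m+n n p)) (pathDegree-new a<n b<n t p p<ℓ))

    newVertex-class : ∀ {v} s → isOdd s ≡ col b xor col v →
                      ∀ p → p < ℓ → col (n + p) xor col v ≡ not (isOdd (p + s))
    newVertex-class {v} s H p p<ℓ with half p
    ... | even i = begin
      col (n + double i) xor col v  ≡⟨ cong (_xor col v) (colour-even col proper-path i (double-cancel-< p<ℓ)) ⟩
      not (col b) xor col v         ≡⟨ not-distribˡ-xor (col b) (col v) ⟨
      not (col b xor col v)         ≡⟨ cong not H ⟨
      not (isOdd s)                 ≡⟨ cong not (isOdd-double-+ i s) ⟨
      not (isOdd (double i + s))    ∎
      where open ≡-Reasoning
    ... | odd i = begin
      col (n + suc (double i)) xor col v  ≡⟨ cong (λ z → col z xor col v) (+-suc n (double i)) ⟩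
      col (suc (n + double i)) xor col v  ≡⟨ cong (_xor col v) (colour-odd col proper-path i i<1+r) ⟩
      col b xor col v                     ≡⟨ H ⟨
      isOdd s                             ≡⟨ isOdd-double-+ i s ⟨
      isOdd (double i + s)                ≡⟨ not-involutive _ ⟨
      not (not (isOdd (double i + s)))    ≡⟨ cong not (isOdd-suc (double i + s)) ⟨
      not (isOdd (suc (double i) + s))    ∎
      where
        open ≡-Reasoning
        i<1+r = double-cancel-< (<-trans (n<1+n _) p<ℓ)

    newVertex-prescribed : ∀ {v} s q → isOdd s ≡ col b xor col v →
                           (∀ p → n + p ≡ v → suc p ≡ q) → (∀ p → suc p ≡ q → n + p ≡ v) →
                           ∀ p → p < ℓ → Prescribed col v (n + p) (adjacentSum (defectPattern s q) p)
    newVertex-prescribed s q H to-q from-q p p<ℓ with suc p ≟ q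
    ... | yes refl =
      prescribed-root (from-q p refl)
        (subst (λ β → Fits β (adjacentSum (defectPattern s (suc p)) p)) p+s-odd (defectPattern-at s p))
      where
        p+s-odd : isOdd (p + s) ≡ true
        p+s-odd = not-injective (trans (sym (newVertex-class s H p p<ℓ)) (xor-≡ (cong col (from-q p refl))))
    ... | no 1+p≢q =
      prescribed-off-root (λ n+p≡v → 1+p≢q (to-q p n+p≡v))
        (subst (λ β → Fits β (adjacentSum (defectPattern s q) p)) (sym (newVertex-class s H p p<ℓ))
               (defectPattern-away s q p 1+p≢q))

    rooted-old : ∀ {v} → v < n → ∀ s → isOdd s ≡ col b xor col v → toℕ (cyclePattern (2 + s)) ≡ 0 →
                 Rooted (n + ℓ) pasted col v
    rooted-old {v} v<n s H silent with rootable col proper-old v v<n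
    ... | W , prescribed-W =
      extend-rooted W t (λ x x<n → subst (Prescribed col v x) (sym (unchanged x<n)) (prescribed-W x x<n))
        (newVertex-prescribed s 0 H (λ p n+p≡v → contradiction (subst (n ≤_) n+p≡v (m≤m+n n p)) (<⇒≱ v<n))
                                    (λ p ()))
      where
        t = defectPattern s 0
        unchanged : ∀ {x} → x < n → degree W x + pathDegree t x ≡ degree W x
        unchanged {x} x<n =
          trans (cong (degree W x +_)
                      (pathDegree-quiet a<n b<n a≢b t silent
                                        (trans (cong toℕ (defectPattern-end s 0 z≤n)) silent) x<n))
                (+-identityʳ _)

    rooted-new : ∀ p₀ → p₀ < ℓ → ∀ s {u u′} → u < n → col u ≡ col (n + p₀) → col u′ ≢ col u →
                 isOdd s ≡ col b xor col (n + p₀) →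
                 pathDegree (defectPattern s (suc p₀)) u ≡ 1 → pathDegree (defectPattern s (suc p₀)) u′ ≡ 0 →
                 (∀ x → x < n → x ≢ u → x ≢ u′ → pathDegree (defectPattern s (suc p₀)) x ≡ 0) →
                 Rooted (n + ℓ) pasted col (n + p₀)
    rooted-new p₀ p₀<ℓ s {u} u<n cu≡cv cu′≢cu H eu≡1 eu′≡0 e-elsewhere with rootable col proper-old u u<n
    ... | W , prescribed-W =
      extend-rooted W t
        (reroot (degree W) (pathDegree t) u<n (m≤m+n n p₀) cu≡cv cu′≢cu prescribed-W eu≡1 eu′≡0 e-elsewhere)
        (newVertex-prescribed s (suc p₀) H (λ p n+p≡v → cong suc (+-cancelˡ-≡ n p p₀ n+p≡v))
                                           (λ p 1+p≡q → cong (n +_) (suc-injective 1+p≡q)))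
      where t = defectPattern s (suc p₀)

    rooted : ∀ {v} → OldOrNew n v → v < n + ℓ → Rooted (n + ℓ) pasted col v
    -- Phases 0 and 3 weigh both end edges cyclePattern 2 = cyclePattern 5 = 0; for a new root,
    -- phase 0 weighs the end edges at b and a by 1 and 0, phase 1 by 0 and 1.
    rooted {v} (old v<n) _ with col b ≟ᴮ col v
    ... | yes cb≡cv = rooted-old v<n 0 (sym (xor-≡ cb≡cv)) refl
    ... | no  cb≢cv = rooted-old v<n 3 (sym (xor-≢ cb≢cv)) refl
    rooted (new p₀) v<N with col b ≟ᴮ col (n + p₀)
    ... | yes cb≡cv =
      rooted-new p₀ p₀<ℓ 0 b<n cb≡cv ca≢cb (sym (xor-≡ cb≡cv))
        (pathDegree-b a<n b<n a≢b (defectPattern 0 (suc p₀)))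
        (trans (pathDegree-a a<n b<n a≢b (defectPattern 0 (suc p₀)))
               (cong toℕ (defectPattern-end 0 (suc p₀) p₀<ℓ)))
        (λ x x<n x≢b x≢a → pathDegree-old a<n b<n (defectPattern 0 (suc p₀)) x<n x≢a x≢b)
      where p₀<ℓ = +-cancelˡ-< n p₀ ℓ v<N
    ... | no cb≢cv =
      rooted-new p₀ p₀<ℓ 1 a<n (trans (¬-not ca≢cb) (sym (¬-not (≢-sym cb≢cv)))) (≢-sym ca≢cb)
        (sym (xor-≢ cb≢cv))
        (trans (pathDegree-a a<n b<n a≢b (defectPattern 1 (suc p₀)))
               (cong toℕ (defectPattern-end 1 (suc p₀) p₀<ℓ)))
        (pathDegree-b a<n b<n a≢b (defectPattern 1 (suc p₀)))
        (λ x x<n x≢a x≢b → pathDegree-old a<n b<n (defectPattern 1 (suc p₀)) x<n x≢a x≢b)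
      where p₀<ℓ = +-cancelˡ-< n p₀ ℓ v<N

  pasted-rootable : Rootable (n + ℓ) pasted
  pasted-rootable col proper v v<N = Coloured.rooted proper (oldOrNew n v) v<N

k2-rootable : Rootable 2 [ (0 , 1) ]
k2-rootable col (c0≢c1 ∷ []) v v<2 = (1F ∷ []) , prescribed v v<2
  where
    prescribed : ∀ v → v < 2 → ∀ x → x < 2 → Prescribed col v x (degree {[ (0 , 1) ]} (1F ∷ []) x)
    prescribed 0 _ 0 _ = prescribed-root refl refl
    prescribed 0 _ 1 _ = prescribed-across (≢-sym c0≢c1) refl
    prescribed 1 _ 0 _ = prescribed-across c0≢c1 refl
    prescribed 1 _ 1 _ = prescribed-root refl refl
    prescribed (suc (suc _)) (s≤s (s≤s ())) _ _
    prescribed (suc zero) _ (suc (suc _)) (s≤s (s≤s ()))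
    prescribed zero _ (suc (suc _)) (s≤s (s≤s ()))

edge-cong : ∀ {p p′ q q′ : ℕ} → p ≡ p′ → q ≡ q′ → (p , q) ≡ (p′ , q′)
edge-cong = cong₂ _,_

newGreen≡ : ∀ n k a b → newGreen n k ≡ Path.greenPath n (suc (double k)) a b
newGreen≡ n k a b =
  trans (map-upTo edge (2 * suc k))
        (trans (cong (applyUpTo edge) (sym (double≡2* (suc k)))) (applyUpTo-pairs n _ edge edge≡))
  where
    edge : ℕ → Edge
    edge j = (n + 2 * j , n + 2 * j + 1)

    edge≡ : ∀ j → edge j ≡ (n + double j , suc (n + double j))
    edge≡ j = edge-cong (cong (n +_) 2j≡) (trans (+-comm (n + 2 * j) 1) (cong (λ m → suc (n + m)) 2j≡))
      where 2j≡ = sym (double≡2* j)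

newRed≡ : ∀ n k a b → newRed n k a b ≡ Path.redPath n (suc (double k)) a b
newRed≡ n k a b = cong ((b , n) ∷_) (cong₂ _++_ middle≡ (cong (λ z → [ (z , a) ]) last≡))
  where
    edge : ℕ → Edge
    edge j = (n + 2 * j + 1 , n + 2 * j + 2)

    edge≡ : ∀ j → edge j ≡ (suc n + double j , suc (suc n + double j))
    edge≡ j = edge-cong (trans (+-comm (n + 2 * j) 1) (cong (λ m → suc (n + m)) 2j≡))
                        (trans (+-comm (n + 2 * j) 2) (cong (λ m → suc (suc (n + m))) 2j≡))
      where 2j≡ = sym (double≡2* j)

    middle≡ : map edge (upTo (1 + 2 * k)) ≡ pairs (suc n) (suc (double k))
    middle≡ = trans (map-upTo edge (1 + 2 * k))
                    (trans (cong (λ m → applyUpTo edge (suc m)) (sym (double≡2* k)))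
                           (applyUpTo-pairs (suc n) _ edge edge≡))

    arith : ∀ n m → n + m + 3 ≡ suc (n + suc (suc m))
    arith = solve-∀

    last≡ : n + 4 * k + 3 ≡ suc (n + double (suc (double k)))
    last≡ = trans (arith n (4 * k)) (cong (λ m → suc (n + suc (suc m))) (sym (quadruple≡4* k)))

size≡ : ∀ n k → n + 4 * suc k ≡ n + double (double (suc k))
size≡ n k = cong (n +_) (sym (quadruple≡4* (suc k)))

cactus-bounded : ∀ {n red green} → OddCactus n red green → All (Below n) (red ++ green)
cactus-bounded k2 = (s≤s z≤n , s≤s (s≤s z≤n)) ∷ []
cactus-bounded (paste {n} {red} {green} c a b ab∈green k)
  rewrite newRed≡ n k a b | newGreen≡ n k a b | size≡ n k =
  All-interleave red green (Path.redPath n r a b) (Path.greenPath n r a b)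
    (All.map (λ (p<n , q<n) → <-≤-trans p<n n≤N , <-≤-trans q<n n≤N) bounded)
    (Path.path-below n r a b (proj₁ ab<n) (proj₂ ab<n))
  where
    r = suc (double k)
    bounded = cactus-bounded c
    n≤N = m≤m+n n (double (double (suc k)))
    ab<n = All-lookup-sym Below-sym (proj₂ (++⁻ red bounded)) ab∈green

cactus-rootable : ∀ {n red green} → OddCactus n red green → Rootable n (red ++ green)
cactus-rootable k2 = k2-rootable
cactus-rootable (paste {n} c a b ab∈green k)
  rewrite newRed≡ n k a b | newGreen≡ n k a b | size≡ n k =
  Pasting.pasted-rootable (cactus-bounded c) (cactus-rootable c) ab∈green k

lemma7 : ∀ {n : ℕ} {red green : List Edge} → OddCactus n red green →
         ¬ (n ≡ 2 × length (red ++ green) ≡ 1) →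
         (v : ℕ) → v < n →
         (col : ℕ → Bool) → All (λ e → col (proj₁ e) ≢ col (proj₂ e)) (red ++ green) →
         ∃ λ (w : Fin (length (red ++ green)) → Fin 2) →
           (wdeg (red ++ green) w v ≡ 1)
           × (∀ x → x < n → col x ≢ col v → wdeg (red ++ green) w x ≡ 1)
           × (∀ x → x < n → x ≢ v → col x ≡ col v →
                (wdeg (red ++ green) w x ≡ 0 ⊎ wdeg (red ++ green) w x ≡ 2))
lemma7 cactus _ v v<n col proper =
  weightAt W ,
  subst (_≡ 1) (sym (wdeg≡ v)) (Prescribed.at-root (prescribed v v<n) refl) ,
  (λ x x<n cx≢cv → subst (_≡ 1) (sym (wdeg≡ x)) (Prescribed.across (prescribed x x<n) cx≢cv)) ,
  (λ x x<n x≢v cx≡cv →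
     subst (λ d → d ≡ 0 ⊎ d ≡ 2) (sym (wdeg≡ x)) (Prescribed.beside (prescribed x x<n) x≢v cx≡cv))
  where
    rooted = cactus-rootable cactus col proper v v<n
    W = proj₁ rooted
    prescribed = proj₂ rooted
    wdeg≡ = wdeg-weightAt W
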